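{- Let $F$ be a graph. (i) If $t\ge 2$ and $F$ has at least one edge, then a linear hypergraph does not contain any $t$-heavy copy of $F$. (ii) Let $r\ge 2$, $t\ge1$, $m=\min\{\binom{r}{2},|E(F)|\}$ and $t'=\lfloor t/m\rfloor$. Then every $r$-uniform $t$-heavy copy of $F$ contains a $t'$-wise Berge copy of $F$ (a member of $\mathbb{B}^r_{t'}F$). (iii) If $t\ge |V(F)|+|E(F)|-2$, then every $3$-uniform $t$-heavy copy of $F$ contains $F^{+3}$.
   Context: A hypergraph consists of a finite vertex set and a set of distinct subsets of it (hyperedges); it is $r$-uniform if all hyperedges have size $r$; it is linear if any two distinct hyperedges share at most one vertex. Containment means as a subhypergraph. For an integer $t\ge1$ and a graph $F$, a hypergraph $\mathcal{F}$ is a $t$-heavy copy of $F$ if there exist an injection $i:V(F)\to V(\mathcal{F})$ and a map $h$ assigning to each edge $e$ of $F$ a set $h(e)$ of $t$ distinct hyperedges of $\mathcal{F}$ such that for every edge $e=xy$ of $F$, $\{i(x),i(y)\}\subseteq A$ for all $A\in h(e)$. It is a $t$-wise Berge copy if moreover $|E(\mathcal{F})|=t|E(F)|$ and such $i,h$ exist with $h(e)\cap h(e')=\emptyset$ for distinct edges $e,e'$. $\mathbb{B}^r_tF$ is the family of $r$-uniform $t$-wise Berge copies of $F$. The $3$-uniform expansion $F^{+3}$ of $F$ is the $3$-uniform hypergraph obtained by adding $|E(F)|$ new vertices to $V(F)$ and replacing each edge $e$ of $F$ by the hyperedge $e\cup\{v_e\}$, where the new vertices $v_e$ are distinct for distinct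 edges. -}

module Defs where

open import Data.Nat using (ℕ; _≤_; _*_; _+_)
open import Data.Nat.Combinatorics using (_C_)
open import Data.Fin using (Fin)
open import Data.Fin.Subset using (Subset; _∈_; _∩_; ∣_∣; ⁅_⁆)
open import Data.Fin.Subset.Properties using (x∈⁅x⁆; x∈⁅y⁆⇔x≡y)
open import Data.Vec using (_++_)
open import Data.Vec.Properties using (++-injectiveʳ)
open import Data.Product using (Σ; _×_; _,_; ∃)
open import Function.Definitions using (Injective)
open import Function.Bundles using (_⇔_; Equivalence)
open import Relation.Binary.PropositionalEquality using (_≡_; _≢_; subst)

record Hypergraph : Set where
  field
    n        : ℕ
    m        : ℕ
    edge     : Fin m → Subset n
    distinct : Injective _≡_ _≡_ edge
open Hypergraph public

Uniform : ℕ → Hypergraph → Set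
Uniform r H = ∀ j → ∣ edge H j ∣ ≡ r

Linear : Hypergraph → Set
Linear H = ∀ j k → j ≢ k → ∣ edge H j ∩ edge H k ∣ ≤ 1

record Graph : Set where
  field
    hg      : Hypergraph
    uniform : Uniform 2 hg
open Graph public

|V| : Graph → ℕ
|V| F = n (hg F)

|E| : Graph → ℕ
|E| F = m (hg F)

Contains : Hypergraph → Hypergraph → Set
Contains H G =
  Σ (Fin (n G) → Fin (n H)) λ φ → Injective _≡_ _≡_ φ ×
  Σ (Fin (m G) → Fin (m H)) λ ψ → Injective _≡_ _≡_ ψ ×
    (∀ j y → (y ∈ edge H (ψ j)) ⇔ (∃ λ x → x ∈ edge G j × φ x ≡ y))

HeavyData : (t : ℕ) (F : Graph) (H : Hypergraph) → (Fin (|V| F) → Fin (n H)) →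
            (Fin (|E| F) → Fin t → Fin (m H)) → Set
HeavyData t F H i h =
  Injective _≡_ _≡_ i ×
  (∀ e → Injective _≡_ _≡_ (h e)) ×
  (∀ e s x → x ∈ edge (hg F) e → i x ∈ edge H (h e s))

IsHeavyCopy : ℕ → Graph → Hypergraph → Set
IsHeavyCopy t F H =
  Σ (Fin (|V| F) → Fin (n H)) λ i →
  Σ (Fin (|E| F) → Fin t → Fin (m H)) λ h → HeavyData t F H i h

IsBergeCopy : ℕ → Graph → Hypergraph → Set
IsBergeCopy t F H =
  m H ≡ t * |E| F ×
  Σ (Fin (|V| F) → Fin (n H)) λ i →
  Σ (Fin (|E| F) → Fin t → Fin (m H)) λ h → HeavyData t F H i h ×
    (∀ e e' → e ≢ e' → ∀ s s' → h e s ≢ h e' s')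

InBerge : ℕ → ℕ → Graph → Hypergraph → Set
InBerge r t F H = Uniform r H × IsBergeCopy t F H

-- The 3-uniform expansion F^{+3}: vertices Fin (|V| + |E|), the new vertex
-- of edge e being |V| + e; hyperedge e is (edge e) ∪ {|V| + e}.
expansion : Graph → Hypergraph
expansion F = record
  { n = |V| F + |E| F
  ; m = |E| F
  ; edge = λ e → edge (hg F) e ++ ⁅ e ⁆
  ; distinct = λ {e} {e'} eq →
      Equivalence.to x∈⁅y⁆⇔x≡y
        (subst (λ S → e ∈ S) (++-injectiveʳ (edge (hg F) e) (edge (hg F) e') eq) (x∈⁅x⁆ e))
  }

-- (i) The t ≥ 2 hyperedges that a heavy copy assigns to an edge xy all contain
-- the images of both x and y.
-- (ii) Join each edge e of F to the t hyperedges assigned to it. An r-uniform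
-- hyperedge contains at most m = min(C(r,2), |E(F)|) of the endpoint pairs, so by
-- double counting every set K of edges has at least t′|K| neighbours, t′ = ⌊t/m⌋.
-- This is Hall's condition once every edge of F is replaced by t′ copies, and a
-- matching saturating the copies (Hall's theorem, via Rado's deletion argument)
-- is a t′-wise Berge copy.
-- (iii) The hyperedges assigned to e are 3-sets containing the endpoints of e, so
-- their third vertices are pairwise distinct; at most |V(F)| − 2 of them lie in
-- the copy of F, which leaves at least |E(F)| fresh ones. Hall's theorem picks
-- distinct fresh third vertices, and these are the new vertices of F⁺³.

module Submission where

open import Defs

open import Data.Bool using (true; false; _∧_; if_then_else_)
open import Data.Empty using (⊥-elim)
open import Data.Fin as Fin using (Fin; zero; suc; _↑ˡ_; _↑ʳ_; splitAt; join; combine; remQuot)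
open import Data.Fin.Properties as Finₚ using (any?)
open import Data.Fin.Subset
open import Data.Fin.Subset.Properties
open import Data.Nat using (ℕ; zero; suc; _≤_; _<_; _+_; _*_; _∸_; _⊓_; _/_; z≤n; s≤s; _≤?_; _<?_; NonZero)
open import Data.Nat.Combinatorics using (_C_; nCk+nC[k+1]≡[n+1]C[k+1])
open import Data.Nat.DivMod using (m/n*n≤m)
open import Data.Nat.Induction using (<-wellFounded)
open import Data.Nat.Properties
open import Algebra.Properties.Semiring.Sum +-*-semiring using (sum; sum-syntax; sum-cong-≗; ∑-comm; *-distribˡ-sum)
open import Data.Product using (Σ; ∃; ∃₂; _×_; _,_; proj₁; proj₂)
open import Data.Sum using (_⊎_; inj₁; inj₂; [_,_]′)
open import Data.Vec using ([]; _∷_; _++_; here; there; lookup; tabulate)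
open import Data.Vec.Functional using (updateAt)
open import Data.Vec.Functional.Properties using (updateAt-updates; updateAt-minimal)
open import Data.Vec.Properties using (∷-injective; []=⇒lookup; lookup⇒[]=; lookup-zipWith; lookup∘tabulate)
open import Function using (_∘_)
open import Function.Bundles using (Equivalence; mk⇔; _⇔_)
open import Function.Definitions using (Injective)
open import Induction.WellFounded using (Acc; acc)
open import Relation.Binary.PropositionalEquality
open import Relation.Binary.PropositionalEquality.Properties using (subst-injective)
open import Relation.Nullary using (¬_; yes; no)
open import Relation.Nullary.Decidable using (_×-dec_; ¬?)

private
  variable
    k N : ℕ

∣p∪q∣+∣p∩q∣≡∣p∣+∣q∣ : (p q : Subset N) → ∣ p ∪ q ∣ + ∣ p ∩ q ∣ ≡ ∣ p ∣ + ∣ q ∣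
∣p∪q∣+∣p∩q∣≡∣p∣+∣q∣ []            []            = refl
∣p∪q∣+∣p∩q∣≡∣p∣+∣q∣ (inside ∷ p)  (inside ∷ q)  =
  cong suc (trans (+-suc _ _) (trans (cong suc (∣p∪q∣+∣p∩q∣≡∣p∣+∣q∣ p q)) (sym (+-suc _ _))))
∣p∪q∣+∣p∩q∣≡∣p∣+∣q∣ (inside ∷ p)  (outside ∷ q) = cong suc (∣p∪q∣+∣p∩q∣≡∣p∣+∣q∣ p q)
∣p∪q∣+∣p∩q∣≡∣p∣+∣q∣ (outside ∷ p) (inside ∷ q)  = trans (cong suc (∣p∪q∣+∣p∩q∣≡∣p∣+∣q∣ p q)) (sym (+-suc _ _))
∣p∪q∣+∣p∩q∣≡∣p∣+∣q∣ (outside ∷ p) (outside ∷ q) = ∣p∪q∣+∣p∩q∣≡∣p∣+∣q∣ p q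

∣p∪q∣≤∣p∣+∣q∣ : (p q : Subset N) → ∣ p ∪ q ∣ ≤ ∣ p ∣ + ∣ q ∣
∣p∪q∣≤∣p∣+∣q∣ p q = ≤-trans (m≤m+n _ _) (≤-reflexive (∣p∪q∣+∣p∩q∣≡∣p∣+∣q∣ p q))

∣⁅x⁆∪p∣≡1+∣p∣ : {x : Fin N} {p : Subset N} → x ∉ p → ∣ ⁅ x ⁆ ∪ p ∣ ≡ suc ∣ p ∣
∣⁅x⁆∪p∣≡1+∣p∣ {x = zero}  {inside ∷ p}  x∉p = ⊥-elim (x∉p here)
∣⁅x⁆∪p∣≡1+∣p∣ {x = zero}  {outside ∷ p} x∉p = cong (suc ∘ ∣_∣) (∪-identityˡ p)
∣⁅x⁆∪p∣≡1+∣p∣ {x = suc x} {inside ∷ p}  x∉p = cong suc (∣⁅x⁆∪p∣≡1+∣p∣ (x∉p ∘ there))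
∣⁅x⁆∪p∣≡1+∣p∣ {x = suc x} {outside ∷ p} x∉p = ∣⁅x⁆∪p∣≡1+∣p∣ (x∉p ∘ there)

∣p─q∣+∣q∣≡∣p∣ : {p q : Subset N} → q ⊆ p → ∣ p ─ q ∣ + ∣ q ∣ ≡ ∣ p ∣
∣p─q∣+∣q∣≡∣p∣ {p = []}          {[]}          q⊆p = refl
∣p─q∣+∣q∣≡∣p∣ {p = inside ∷ p}  {inside ∷ q}  q⊆p = trans (+-suc _ _) (cong suc (∣p─q∣+∣q∣≡∣p∣ (drop-∷-⊆ q⊆p)))
∣p─q∣+∣q∣≡∣p∣ {p = outside ∷ p} {inside ∷ q}  q⊆p with () ← q⊆p here
∣p─q∣+∣q∣≡∣p∣ {p = inside ∷ p}  {outside ∷ q} q⊆p = cong suc (∣p─q∣+∣q∣≡∣p∣ (drop-∷-⊆ q⊆p))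
∣p─q∣+∣q∣≡∣p∣ {p = outside ∷ p} {outside ∷ q} q⊆p = ∣p─q∣+∣q∣≡∣p∣ (drop-∷-⊆ q⊆p)

x∈p─q⇒x∉q : {x : Fin N} {p q : Subset N} → x ∈ p ─ q → x ∉ q
x∈p─q⇒x∉q {p = _ ∷ _} {inside ∷ _} ()        here
x∈p─q⇒x∉q {p = _ ∷ _} {_ ∷ _} (there x∈) (there x∈q) = x∈p─q⇒x∉q x∈ x∈q

∣q∣<∣p∣⇒∃∈∉ : {p q : Subset N} → ∣ q ∣ < ∣ p ∣ → ∃ λ x → x ∈ p × x ∉ q
∣q∣<∣p∣⇒∃∈∉ {p = p} {q} ∣q∣<∣p∣ with any? (λ x → x ∈? p ×-dec ¬? (x ∈? q))
... | yes witness = witness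
... | no  none    = ⊥-elim (<⇒≱ ∣q∣<∣p∣ (p⊆q⇒∣p∣≤∣q∣ p⊆q))
  where
  p⊆q : p ⊆ q
  p⊆q {x} x∈p with x ∈? q
  ... | yes x∈q = x∈q
  ... | no  x∉q = ⊥-elim (none (x , x∈p , x∉q))

∣p∣≤1⇒x≡y : {p : Subset N} {x y : Fin N} → ∣ p ∣ ≤ 1 → x ∈ p → y ∈ p → x ≡ y
∣p∣≤1⇒x≡y {p = p} {x} {y} ∣p∣≤1 x∈p y∈p with x Fin.≟ y
... | yes x≡y = x≡y
... | no  x≢y = ⊥-elim (1+n≰n (begin
  2                    ≡⟨ cong suc (∣⁅x⁆∣≡1 y) ⟨
  suc ∣ ⁅ y ⁆ ∣        ≡⟨ ∣⁅x⁆∪p∣≡1+∣p∣ {x = x} {⁅ y ⁆} (x≢y ∘ x∈⁅y⁆⇒x≡y y) ⟨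
  ∣ ⁅ x ⁆ ∪ ⁅ y ⁆ ∣    ≤⟨ p⊆q⇒∣p∣≤∣q∣ pair⊆p ⟩
  ∣ p ∣                ≤⟨ ∣p∣≤1 ⟩
  1                    ∎))
  where
  open ≤-Reasoning
  pair⊆p : ⁅ x ⁆ ∪ ⁅ y ⁆ ⊆ p
  pair⊆p z∈ with x∈p∪q⁻ ⁅ x ⁆ ⁅ y ⁆ z∈
  ... | inj₁ z∈⁅x⁆ rewrite x∈⁅y⁆⇒x≡y x z∈⁅x⁆ = x∈p
  ... | inj₂ z∈⁅y⁆ rewrite x∈⁅y⁆⇒x≡y y z∈⁅y⁆ = y∈p

∃-two-distinct : {p : Subset N} → 2 ≤ ∣ p ∣ → ∃₂ λ x y → x ∈ p × y ∈ p × x ≢ y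
∃-two-distinct {N} {p} 2≤∣p∣
  with x , x∈p , _ ← ∣q∣<∣p∣⇒∃∈∉ {q = ⊥} (subst (_< ∣ p ∣) (sym (∣⊥∣≡0 N)) (≤-trans (s≤s z≤n) 2≤∣p∣))
  with y , y∈p , y∉⁅x⁆ ← ∣q∣<∣p∣⇒∃∈∉ {q = ⁅ x ⁆} (subst (_< ∣ p ∣) (sym (∣⁅x⁆∣≡1 x)) 2≤∣p∣)
  = x , y , x∈p , y∈p , λ x≡y → y∉⁅x⁆ (subst (_∈ ⁅ x ⁆) x≡y (x∈⁅x⁆ x))

∣p∣≡1+∣q∣⇒∃!∉ : {p q : Subset N} → q ⊆ p → ∣ p ∣ ≡ suc ∣ q ∣ →
                ∃ λ z → z ∈ p × z ∉ q × (∀ {y} → y ∈ p → y ∈ q ⊎ y ≡ z)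
∣p∣≡1+∣q∣⇒∃!∉ {p = p} {q} q⊆p ∣p∣≡1+∣q∣
  with z , z∈p , z∉q ← ∣q∣<∣p∣⇒∃∈∉ {p = p} {q} (≤-reflexive (sym ∣p∣≡1+∣q∣))
  = z , z∈p , z∉q , unique
  where
  unique : ∀ {y} → y ∈ p → y ∈ q ⊎ y ≡ z
  unique {y} y∈p with y ∈? q | y Fin.≟ z
  ... | yes y∈q | _       = inj₁ y∈q
  ... | no  _   | yes y≡z = inj₂ y≡z
  ... | no  y∉q | no  y≢z = ⊥-elim (1+n≰n (begin
    suc ∣ p ∣                 ≡⟨ cong suc ∣p∣≡1+∣q∣ ⟩
    suc (suc ∣ q ∣)           ≡⟨ cong suc (∣⁅x⁆∪p∣≡1+∣p∣ z∉q) ⟨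
    suc ∣ ⁅ z ⁆ ∪ q ∣         ≡⟨ ∣⁅x⁆∪p∣≡1+∣p∣ y∉z∪q ⟨
    ∣ ⁅ y ⁆ ∪ ⁅ z ⁆ ∪ q ∣     ≤⟨ p⊆q⇒∣p∣≤∣q∣ y∪z∪q⊆p ⟩
    ∣ p ∣                     ∎))
    where
    open ≤-Reasoning
    y∉z∪q : y ∉ ⁅ z ⁆ ∪ q
    y∉z∪q y∈ with x∈p∪q⁻ ⁅ z ⁆ q y∈
    ... | inj₁ y∈⁅z⁆ = y≢z (x∈⁅y⁆⇒x≡y z y∈⁅z⁆)
    ... | inj₂ y∈q   = y∉q y∈q
    y∪z∪q⊆p : ⁅ y ⁆ ∪ ⁅ z ⁆ ∪ q ⊆ p
    y∪z∪q⊆p x∈ with x∈p∪q⁻ ⁅ y ⁆ _ x∈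
    ... | inj₁ x∈⁅y⁆ rewrite x∈⁅y⁆⇒x≡y y x∈⁅y⁆ = y∈p
    ... | inj₂ x∈ with x∈p∪q⁻ ⁅ z ⁆ q x∈
    ...   | inj₁ x∈⁅z⁆ rewrite x∈⁅y⁆⇒x≡y z x∈⁅z⁆ = z∈p
    ...   | inj₂ x∈q   = q⊆p x∈q

enum : (p : Subset N) → Fin ∣ p ∣ → Fin N
enum (inside ∷ p)  zero    = zero
enum (inside ∷ p)  (suc j) = suc (enum p j)
enum (outside ∷ p) j       = suc (enum p j)

enum-∈ : (p : Subset N) (j : Fin ∣ p ∣) → enum p j ∈ p
enum-∈ (inside ∷ p)  zero    = here
enum-∈ (inside ∷ p)  (suc j) = there (enum-∈ p j)
enum-∈ (outside ∷ p) j       = there (enum-∈ p j)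

enum-injective : (p : Subset N) → Injective _≡_ _≡_ (enum p)
enum-injective (inside ∷ p)  {zero}  {zero}  _  = refl
enum-injective (inside ∷ p)  {suc i} {suc j} eq = cong suc (enum-injective p (Finₚ.suc-injective eq))
enum-injective (outside ∷ p)                 eq = enum-injective p (Finₚ.suc-injective eq)

neighbours : (Fin k → Subset N) → Subset k → Subset N
neighbours {k = zero}  Γ []            = ⊥
neighbours {k = suc k} Γ (inside ∷ S)  = Γ zero ∪ neighbours (Γ ∘ suc) S
neighbours {k = suc k} Γ (outside ∷ S) = neighbours (Γ ∘ suc) S

∈-neighbours⁺ : {Γ : Fin k → Subset N} {S : Subset k} {e : Fin k} {y : Fin N} →
                e ∈ S → y ∈ Γ e → y ∈ neighbours Γ S
∈-neighbours⁺ {S = inside ∷ S}  here       y∈ = x∈p∪q⁺ (inj₁ y∈)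
∈-neighbours⁺ {S = inside ∷ S}  (there e∈) y∈ = x∈p∪q⁺ (inj₂ (∈-neighbours⁺ e∈ y∈))
∈-neighbours⁺ {S = outside ∷ S} (there e∈) y∈ = ∈-neighbours⁺ e∈ y∈

∈-neighbours⁻ : {Γ : Fin k → Subset N} (S : Subset k) {y : Fin N} →
                y ∈ neighbours Γ S → ∃ λ e → e ∈ S × y ∈ Γ e
∈-neighbours⁻ []            y∈ = ⊥-elim (∉⊥ y∈)
∈-neighbours⁻ {Γ = Γ} (inside ∷ S)  y∈ with x∈p∪q⁻ (Γ zero) _ y∈
... | inj₁ y∈Γ₀ = zero , here , y∈Γ₀
... | inj₂ y∈   with e , e∈ , y∈Γe ← ∈-neighbours⁻ S y∈ = suc e , there e∈ , y∈Γe
∈-neighbours⁻ (outside ∷ S) y∈ with e , e∈ , y∈Γe ← ∈-neighbours⁻ S y∈ = suc e , there e∈ , y∈Γe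

neighbours-least : {Γ : Fin k → Subset N} (S : Subset k) {X : Subset N} → (∀ {e} → e ∈ S → Γ e ⊆ X) → neighbours Γ S ⊆ X
neighbours-least S Γ⊆X y∈ with e , e∈ , y∈Γe ← ∈-neighbours⁻ S y∈ = Γ⊆X e∈ y∈Γe

∣neighbours∣≤b*∣S∣ : {Γ : Fin k → Subset N} {b : ℕ} → (∀ e → ∣ Γ e ∣ ≤ b) → ∀ S → ∣ neighbours Γ S ∣ ≤ b * ∣ S ∣
∣neighbours∣≤b*∣S∣ {N = N} _ [] = ≤-trans (≤-reflexive (∣⊥∣≡0 N)) z≤n
∣neighbours∣≤b*∣S∣ {Γ = Γ} {b} ∣Γ∣≤b (inside ∷ S) = begin
  ∣ Γ zero ∪ neighbours (Γ ∘ suc) S ∣         ≤⟨ ∣p∪q∣≤∣p∣+∣q∣ (Γ zero) _ ⟩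
  ∣ Γ zero ∣ + ∣ neighbours (Γ ∘ suc) S ∣     ≤⟨ +-mono-≤ (∣Γ∣≤b zero) (∣neighbours∣≤b*∣S∣ (∣Γ∣≤b ∘ suc) S) ⟩
  b + b * ∣ S ∣                              ≡⟨ *-suc b ∣ S ∣ ⟨
  b * suc ∣ S ∣                              ∎
  where open ≤-Reasoning
∣neighbours∣≤b*∣S∣ ∣Γ∣≤b (outside ∷ S) = ∣neighbours∣≤b*∣S∣ (∣Γ∣≤b ∘ suc) S

image : (Fin k → Fin N) → Subset k → Subset N
image f = neighbours (⁅_⁆ ∘ f)

∈-image⁺ : {f : Fin k → Fin N} {p : Subset k} {x : Fin k} → x ∈ p → f x ∈ image f p
∈-image⁺ {f = f} x∈p = ∈-neighbours⁺ x∈p (x∈⁅x⁆ (f _))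

∈-image⁻ : (f : Fin k → Fin N) {p : Subset k} {y : Fin N} → y ∈ image f p → ∃ λ x → x ∈ p × f x ≡ y
∈-image⁻ f {p} y∈ with x , x∈p , y∈⁅fx⁆ ← ∈-neighbours⁻ p y∈ = x , x∈p , sym (x∈⁅y⁆⇒x≡y (f x) y∈⁅fx⁆)

∣image∣≡∣p∣ : {f : Fin k → Fin N} → Injective _≡_ _≡_ f → (p : Subset k) → ∣ image f p ∣ ≡ ∣ p ∣
∣image∣≡∣p∣ {N = N} f-inj [] = ∣⊥∣≡0 N
∣image∣≡∣p∣ {f = f} f-inj (inside ∷ p) = begin
  ∣ ⁅ f zero ⁆ ∪ image (f ∘ suc) p ∣  ≡⟨ ∣⁅x⁆∪p∣≡1+∣p∣ f₀∉ ⟩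
  suc ∣ image (f ∘ suc) p ∣           ≡⟨ cong suc (∣image∣≡∣p∣ (Finₚ.suc-injective ∘ f-inj) p) ⟩
  suc ∣ p ∣                           ∎
  where
  open ≡-Reasoning
  f₀∉ : f zero ∉ image (f ∘ suc) p
  f₀∉ f₀∈ with _ , _ , eq ← ∈-image⁻ (f ∘ suc) f₀∈ with () ← f-inj eq
∣image∣≡∣p∣ f-inj (outside ∷ p) = ∣image∣≡∣p∣ (Finₚ.suc-injective ∘ f-inj) p

image-⊆⁻ : {f : Fin k → Fin N} → Injective _≡_ _≡_ f → {p q : Subset k} →
           image f p ⊆ image f q → p ⊆ q
image-⊆⁻ {f = f} f-inj {q = q} fp⊆fq x∈p with _ , x′∈q , eq ← ∈-image⁻ f (fp⊆fq (∈-image⁺ x∈p)) =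
  subst (_∈ q) (f-inj eq) x′∈q

∑-mono-≤ : {f g : Fin k → ℕ} → (∀ e → f e ≤ g e) → sum f ≤ sum g
∑-mono-≤ {k = zero}  f≤g = z≤n
∑-mono-≤ {k = suc k} f≤g = +-mono-≤ (f≤g zero) (∑-mono-≤ (f≤g ∘ suc))

∑-mono-< : {f g : Fin k → ℕ} → (∀ e → f e ≤ g e) → ∀ v → f v < g v → sum f < sum g
∑-mono-< f≤g zero    fv<gv = +-mono-<-≤ fv<gv (∑-mono-≤ (f≤g ∘ suc))
∑-mono-< f≤g (suc v) fv<gv = +-mono-≤-< (f≤g zero) (∑-mono-< (f≤g ∘ suc) v fv<gv)

-- Hall's theorem

HallCondition : (Fin k → Subset N) → Set
HallCondition Γ = ∀ S → ∣ S ∣ ≤ ∣ neighbours Γ S ∣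

Transversal : (Fin k → Subset N) → Set
Transversal {k} {N} Γ = Σ (Fin k → Fin N) λ f → Injective _≡_ _≡_ f × (∀ e → f e ∈ Γ e)

transversal-mono : {Γ Δ : Fin k → Subset N} → (∀ e → Δ e ⊆ Γ e) → Transversal Δ → Transversal Γ
transversal-mono Δ⊆Γ (f , f-inj , f∈Δ) = f , f-inj , λ e → Δ⊆Γ e (f∈Δ e)

k≤∣Γ∣⇒hallCondition : {Γ : Fin k → Subset N} → (∀ e → k ≤ ∣ Γ e ∣) → HallCondition Γ
k≤∣Γ∣⇒hallCondition {k = k} {Γ = Γ} k≤∣Γ∣ S with nonempty? S
... | yes (e , e∈S) = begin
  ∣ S ∣                 ≤⟨ ∣p∣≤n S ⟩
  k                     ≤⟨ k≤∣Γ∣ e ⟩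
  ∣ Γ e ∣               ≤⟨ p⊆q⇒∣p∣≤∣q∣ (∈-neighbours⁺ e∈S) ⟩
  ∣ neighbours Γ S ∣    ∎
  where open ≤-Reasoning
... | no  S-empty = begin
  ∣ S ∣                 ≡⟨ cong ∣_∣ (Empty-unique S-empty) ⟩
  ∣ ⊥ {n = k} ∣         ≡⟨ ∣⊥∣≡0 k ⟩
  0                     ≤⟨ z≤n ⟩
  ∣ neighbours Γ S ∣    ∎
  where open ≤-Reasoning

Deficient : (Fin k → Subset N) → Subset k → Set
Deficient Γ S = ∣ neighbours Γ S ∣ < ∣ S ∣

hallCondition⊎deficient : (Γ : Fin k → Subset N) → HallCondition Γ ⊎ ∃ (Deficient Γ)
hallCondition⊎deficient Γ with anySubset? (λ S → ∣ neighbours Γ S ∣ <? ∣ S ∣)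
... | yes deficient = inj₂ deficient
... | no  none      = inj₁ (λ S → ≮⇒≥ (λ def → none (S , def)))

delete : (Fin k → Subset N) → Fin k → Fin N → Fin k → Subset N
delete Γ v w = updateAt Γ v (_- w)

module _ {Γ : Fin k → Subset N} {v : Fin k} {w : Fin N} where

  delete-⊆ : ∀ e → delete Γ v w e ⊆ Γ e
  delete-⊆ e with e Fin.≟ v
  ... | yes refl = ⊆-trans (⊆-reflexive (updateAt-updates v Γ)) (p─q⊆p (Γ v) ⁅ w ⁆)
  ... | no  e≢v  = ⊆-reflexive (updateAt-minimal e v Γ e≢v)

  delete-≢ : ∀ {e} → e ≢ v → Γ e ⊆ delete Γ v w e
  delete-≢ {e} e≢v = ⊆-reflexive (sym (updateAt-minimal e v Γ e≢v))

  delete-∈ : ∀ {y} → y ∈ Γ v → y ≢ w → y ∈ delete Γ v w v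
  delete-∈ y∈Γv y≢w = ⊆-reflexive (sym (updateAt-updates v Γ)) (x∈p∧x≢y⇒x∈p-y y∈Γv y≢w)

size : (Fin k → Subset N) → ℕ
size Γ = ∑[ e < _ ] ∣ Γ e ∣

size-delete : {Γ : Fin k → Subset N} {v : Fin k} {w : Fin N} → w ∈ Γ v → size (delete Γ v w) < size Γ
size-delete {Γ = Γ} {v} {w} w∈Γv = ∑-mono-< (p⊆q⇒∣p∣≤∣q∣ ∘ delete-⊆) v (begin-strict
  ∣ delete Γ v w v ∣  ≡⟨ cong ∣_∣ (updateAt-updates v Γ) ⟩
  ∣ Γ v - w ∣         <⟨ x∈p⇒∣p-x∣<∣p∣ w∈Γv ⟩
  ∣ Γ v ∣             ∎)
  where open ≤-Reasoning

module _ {Γ : Fin k → Subset N} (hall : HallCondition Γ) {v : Fin k} where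

  deficient-delete⇒∋ : ∀ {w S} → Deficient (delete Γ v w) S → v ∈ S
  deficient-delete⇒∋ {w} {S} deficient with v ∈? S
  ... | yes v∈S = v∈S
  ... | no  v∉S = ⊥-elim (<⇒≱ deficient (≤-trans (hall S) (p⊆q⇒∣p∣≤∣q∣ unchanged)))
    where
    unchanged : neighbours Γ S ⊆ neighbours (delete Γ v w) S
    unchanged = neighbours-least S λ e∈S →
      ⊆-trans (delete-≢ (λ e≡v → v∉S (subst (_∈ S) e≡v e∈S))) (∈-neighbours⁺ e∈S)

  neighbours-minus⊆ : ∀ {w} S → neighbours Γ (S - v) ⊆ neighbours (delete Γ v w) S
  neighbours-minus⊆ S = neighbours-least (S - v) λ e∈ →
    ⊆-trans (delete-≢ (x∉⁅y⁆⇒x≢y (x∈p─q⇒x∉q e∈))) (∈-neighbours⁺ (p─q⊆p S _ e∈))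

  ∣neighbours∣≤∣S-v∣ : ∀ {w S} → Deficient (delete Γ v w) S → ∣ neighbours (delete Γ v w) S ∣ ≤ ∣ S - v ∣
  ∣neighbours∣≤∣S-v∣ {S = S} deficient = ≤-pred (begin-strict
    ∣ neighbours _ S ∣      <⟨ deficient ⟩
    ∣ S ∣                   ≡⟨ ∣p─q∣+∣q∣≡∣p∣ ⁅v⁆⊆S ⟨
    ∣ S - v ∣ + ∣ ⁅ v ⁆ ∣   ≡⟨ cong (∣ S - v ∣ +_) (∣⁅x⁆∣≡1 v) ⟩
    ∣ S - v ∣ + 1           ≡⟨ +-comm _ 1 ⟩
    suc ∣ S - v ∣           ∎)
    where
    open ≤-Reasoning
    ⁅v⁆⊆S : ⁅ v ⁆ ⊆ S
    ⁅v⁆⊆S x∈⁅v⁆ rewrite x∈⁅y⁆⇒x≡y v x∈⁅v⁆ = deficient-delete⇒∋ deficient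

  neighbours-⁅v⁆∪⊆ : ∀ {w₁ w₂ S₁ S₂} → w₁ ≢ w₂ → v ∈ S₁ → v ∈ S₂ →
                      neighbours Γ (⁅ v ⁆ ∪ (S₁ - v) ∪ (S₂ - v)) ⊆
                      neighbours (delete Γ v w₁) S₁ ∪ neighbours (delete Γ v w₂) S₂
  neighbours-⁅v⁆∪⊆ {w₁} {w₂} {S₁} {S₂} w₁≢w₂ v∈S₁ v∈S₂ = neighbours-least _ (λ e∈ y∈ → covered e∈ y∈)
    where
    covered : ∀ {e y} → e ∈ ⁅ v ⁆ ∪ (S₁ - v) ∪ (S₂ - v) → y ∈ Γ e →
              y ∈ neighbours (delete Γ v w₁) S₁ ∪ neighbours (delete Γ v w₂) S₂
    covered {e} {y} e∈ y∈ with x∈p∪q⁻ ⁅ v ⁆ _ e∈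
    ... | inj₂ e∈A with x∈p∪q⁻ (S₁ - v) (S₂ - v) e∈A
    ...   | inj₁ e∈A₁ = x∈p∪q⁺ (inj₁ (neighbours-minus⊆ S₁ (∈-neighbours⁺ e∈A₁ y∈)))
    ...   | inj₂ e∈A₂ = x∈p∪q⁺ (inj₂ (neighbours-minus⊆ S₂ (∈-neighbours⁺ e∈A₂ y∈)))
    covered {e} {y} e∈ y∈ | inj₁ e∈⁅v⁆ with refl ← x∈⁅y⁆⇒x≡y v e∈⁅v⁆ with y Fin.≟ w₁
    ... | yes refl = x∈p∪q⁺ (inj₂ (∈-neighbours⁺ v∈S₂ (delete-∈ {Γ = Γ} {v} y∈ w₁≢w₂)))
    ... | no  y≢w₁ = x∈p∪q⁺ (inj₁ (∈-neighbours⁺ v∈S₁ (delete-∈ {Γ = Γ} {v} y∈ y≢w₁)))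

  neighbours-∩⊆ : ∀ {w₁ w₂} S₁ S₂ → neighbours Γ ((S₁ - v) ∩ (S₂ - v)) ⊆
                  neighbours (delete Γ v w₁) S₁ ∩ neighbours (delete Γ v w₂) S₂
  neighbours-∩⊆ {w₁} {w₂} S₁ S₂ = neighbours-least ((S₁ - v) ∩ (S₂ - v)) λ e∈ y∈ → x∈p∩q⁺
    ( neighbours-minus⊆ {w = w₁} S₁ (∈-neighbours⁺ (p∩q⊆p (S₁ - v) (S₂ - v) e∈) y∈)
    , neighbours-minus⊆ {w = w₂} S₂ (∈-neighbours⁺ (p∩q⊆q (S₁ - v) (S₂ - v) e∈) y∈))

  -- Submodularity: S₁ ∪ S₂ and (S₁ ∩ S₂) - v would jointly violate Hall's condition for Γ.
  ¬deficient×deficient : ∀ {w₁ w₂ S₁ S₂} → w₁ ≢ w₂ →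
                         ¬ (Deficient (delete Γ v w₁) S₁ × Deficient (delete Γ v w₂) S₂)
  ¬deficient×deficient {w₁} {w₂} {S₁} {S₂} w₁≢w₂ (def₁ , def₂) = 1+n≰n (begin
    suc (∣ A₁ ∪ A₂ ∣ + ∣ A₁ ∩ A₂ ∣)                       ≡⟨ cong (_+ ∣ A₁ ∩ A₂ ∣) (∣⁅x⁆∪p∣≡1+∣p∣ v∉A₁∪A₂) ⟨
    ∣ ⁅ v ⁆ ∪ A₁ ∪ A₂ ∣ + ∣ A₁ ∩ A₂ ∣                      ≤⟨ +-mono-≤ (hall _) (hall _) ⟩
    ∣ neighbours Γ (⁅ v ⁆ ∪ A₁ ∪ A₂) ∣ + ∣ neighbours Γ (A₁ ∩ A₂) ∣
                                         ≤⟨ +-mono-≤ (p⊆q⇒∣p∣≤∣q∣ (neighbours-⁅v⁆∪⊆ w₁≢w₂ v∈S₁ v∈S₂))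
                                                     (p⊆q⇒∣p∣≤∣q∣ (neighbours-∩⊆ {w₁} {w₂} S₁ S₂)) ⟩
    ∣ X₁ ∪ X₂ ∣ + ∣ X₁ ∩ X₂ ∣                             ≡⟨ ∣p∪q∣+∣p∩q∣≡∣p∣+∣q∣ X₁ X₂ ⟩
    ∣ X₁ ∣ + ∣ X₂ ∣                                       ≤⟨ +-mono-≤ (∣neighbours∣≤∣S-v∣ def₁) (∣neighbours∣≤∣S-v∣ def₂) ⟩
    ∣ A₁ ∣ + ∣ A₂ ∣                                       ≡⟨ ∣p∪q∣+∣p∩q∣≡∣p∣+∣q∣ A₁ A₂ ⟨
    ∣ A₁ ∪ A₂ ∣ + ∣ A₁ ∩ A₂ ∣                             ∎)
    where
    open ≤-Reasoning
    A₁ = S₁ - v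
    A₂ = S₂ - v
    X₁ = neighbours (delete Γ v w₁) S₁
    X₂ = neighbours (delete Γ v w₂) S₂
    v∈S₁ = deficient-delete⇒∋ def₁
    v∈S₂ = deficient-delete⇒∋ def₂
    v∉A₁∪A₂ : v ∉ A₁ ∪ A₂
    v∉A₁∪A₂ v∈ with x∈p∪q⁻ A₁ A₂ v∈
    ... | inj₁ v∈A₁ = x∈p─q⇒x∉q v∈A₁ (x∈⁅x⁆ v)
    ... | inj₂ v∈A₂ = x∈p─q⇒x∉q v∈A₂ (x∈⁅x⁆ v)

  hallCondition-delete : ∀ {w₁ w₂} → w₁ ≢ w₂ →
                         HallCondition (delete Γ v w₁) ⊎ HallCondition (delete Γ v w₂)
  hallCondition-delete {w₁} {w₂} w₁≢w₂
    with hallCondition⊎deficient (delete Γ v w₁) | hallCondition⊎deficient (delete Γ v w₂)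
  ... | inj₁ hall₁       | _                = inj₁ hall₁
  ... | inj₂ _           | inj₁ hall₂       = inj₂ hall₂
  ... | inj₂ (_ , def₁)  | inj₂ (_ , def₂)  = ⊥-elim (¬deficient×deficient w₁≢w₂ (def₁ , def₂))

transversal-of-∣Γ∣≤1 : {Γ : Fin k → Subset N} → HallCondition Γ → (∀ e → ∣ Γ e ∣ ≤ 1) → Transversal Γ
transversal-of-∣Γ∣≤1 {k = k} {N} {Γ} hall ∣Γ∣≤1 = f , f-injective , f∈Γ
  where
  nonempty : ∀ e → ∃ λ y → y ∈ Γ e × y ∉ ⊥
  nonempty e = ∣q∣<∣p∣⇒∃∈∉ (begin-strict
    ∣ ⊥ {n = N} ∣              ≡⟨ ∣⊥∣≡0 N ⟩
    0                          <⟨ s≤s z≤n ⟩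
    1                          ≡⟨ ∣⁅x⁆∣≡1 e ⟨
    ∣ ⁅ e ⁆ ∣                  ≤⟨ hall ⁅ e ⁆ ⟩
    ∣ neighbours Γ ⁅ e ⁆ ∣     ≤⟨ p⊆q⇒∣p∣≤∣q∣ (neighbours-least ⁅ e ⁆ λ e′∈ → ⊆-reflexive (cong Γ (x∈⁅y⁆⇒x≡y e e′∈))) ⟩
    ∣ Γ e ∣                    ∎)
    where open ≤-Reasoning
  f : Fin k → Fin N
  f e = proj₁ (nonempty e)
  f∈Γ : ∀ e → f e ∈ Γ e
  f∈Γ e = proj₁ (proj₂ (nonempty e))
  Γ⊆⁅f⁆ : ∀ e → Γ e ⊆ ⁅ f e ⁆
  Γ⊆⁅f⁆ e y∈ = subst (_∈ ⁅ f e ⁆) (∣p∣≤1⇒x≡y (∣Γ∣≤1 e) (f∈Γ e) y∈) (x∈⁅x⁆ (f e))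
  f-injective : Injective _≡_ _≡_ f
  f-injective {e} {e′} fe≡fe′ with e Fin.≟ e′
  ... | yes e≡e′ = e≡e′
  ... | no  e≢e′ = ⊥-elim (1+n≰n (begin
    2                                ≡⟨ cong suc (∣⁅x⁆∣≡1 e′) ⟨
    suc ∣ ⁅ e′ ⁆ ∣                   ≡⟨ ∣⁅x⁆∪p∣≡1+∣p∣ (e≢e′ ∘ x∈⁅y⁆⇒x≡y e′) ⟨
    ∣ ⁅ e ⁆ ∪ ⁅ e′ ⁆ ∣               ≤⟨ hall _ ⟩
    ∣ neighbours Γ (⁅ e ⁆ ∪ ⁅ e′ ⁆) ∣ ≤⟨ p⊆q⇒∣p∣≤∣q∣ (neighbours-least (⁅ e ⁆ ∪ ⁅ e′ ⁆) ⊆⁅fe⁆) ⟩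
    ∣ ⁅ f e ⁆ ∣                      ≡⟨ ∣⁅x⁆∣≡1 (f e) ⟩
    1                                ∎))
    where
    open ≤-Reasoning
    ⊆⁅fe⁆ : ∀ {e″} → e″ ∈ ⁅ e ⁆ ∪ ⁅ e′ ⁆ → Γ e″ ⊆ ⁅ f e ⁆
    ⊆⁅fe⁆ e″∈ with x∈p∪q⁻ ⁅ e ⁆ ⁅ e′ ⁆ e″∈
    ... | inj₁ e″∈⁅e⁆  rewrite x∈⁅y⁆⇒x≡y e e″∈⁅e⁆ = Γ⊆⁅f⁆ e
    ... | inj₂ e″∈⁅e′⁆ rewrite x∈⁅y⁆⇒x≡y e′ e″∈⁅e′⁆ | fe≡fe′ = Γ⊆⁅f⁆ e′

-- Rado's proof: while some Γ v has two elements, one of them can be deleted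
-- without violating Hall's condition.
hall-theorem : {Γ : Fin k → Subset N} → HallCondition Γ → Transversal Γ
hall-theorem {Γ = Γ} = go Γ (<-wellFounded (size Γ))
  where
  go : ∀ Γ → Acc _<_ (size Γ) → HallCondition Γ → Transversal Γ
  go Γ (acc smaller) hall with any? (λ v → 2 ≤? ∣ Γ v ∣)
  ... | no  none = transversal-of-∣Γ∣≤1 hall (λ v → ≤-pred (≰⇒> (λ 2≤ → none (v , 2≤))))
  ... | yes (v , 2≤∣Γv∣)
    with w₁ , w₂ , w₁∈ , w₂∈ , w₁≢w₂ ← ∃-two-distinct {p = Γ v} 2≤∣Γv∣
    with hallCondition-delete hall {v} w₁≢w₂
  ... | inj₁ hall₁ = transversal-mono delete-⊆ (go _ (smaller (size-delete {Γ = Γ} w₁∈)) hall₁)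
  ... | inj₂ hall₂ = transversal-mono delete-⊆ (go _ (smaller (size-delete {Γ = Γ} w₂∈)) hall₂)

restrict : (A : Subset N) → Subset N → Subset ∣ A ∣
restrict []            []      = []
restrict (inside ∷ A)  (b ∷ P) = b ∷ restrict A P
restrict (outside ∷ A) (_ ∷ P) = restrict A P

∣restrict∣ : {A P : Subset N} → P ⊆ A → ∣ restrict A P ∣ ≡ ∣ P ∣
∣restrict∣ {A = []}          {[]}          _   = refl
∣restrict∣ {A = inside ∷ A}  {inside ∷ P}  P⊆A = cong suc (∣restrict∣ (drop-∷-⊆ P⊆A))
∣restrict∣ {A = inside ∷ A}  {outside ∷ P} P⊆A = ∣restrict∣ (drop-∷-⊆ P⊆A)
∣restrict∣ {A = outside ∷ A} {inside ∷ P}  P⊆A with () ← P⊆A here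
∣restrict∣ {A = outside ∷ A} {outside ∷ P} P⊆A = ∣restrict∣ (drop-∷-⊆ P⊆A)

restrict-injective : {A P Q : Subset N} → P ⊆ A → Q ⊆ A → restrict A P ≡ restrict A Q → P ≡ Q
restrict-injective {A = []}         {[]}    {[]}    _ _ _ = refl
restrict-injective {A = inside ∷ A} {_ ∷ _} {_ ∷ _} P⊆A Q⊆A eq with refl , eq′ ← ∷-injective eq =
  cong (_ ∷_) (restrict-injective (drop-∷-⊆ P⊆A) (drop-∷-⊆ Q⊆A) eq′)
restrict-injective {A = outside ∷ A} {inside ∷ _} P⊆A _ _ with () ← P⊆A here
restrict-injective {A = outside ∷ A} {outside ∷ _} {inside ∷ _} _ Q⊆A _ with () ← Q⊆A here
restrict-injective {A = outside ∷ A} {outside ∷ _} {outside ∷ _} P⊆A Q⊆A eq =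
  cong (outside ∷_) (restrict-injective (drop-∷-⊆ P⊆A) (drop-∷-⊆ Q⊆A) eq)

∣p∣≡0⇒p≡⊥ : {p : Subset N} → ∣ p ∣ ≡ 0 → p ≡ ⊥
∣p∣≡0⇒p≡⊥ {p = []}          _      = refl
∣p∣≡0⇒p≡⊥ {p = outside ∷ p} ∣p∣≡0 = cong (outside ∷_) (∣p∣≡0⇒p≡⊥ ∣p∣≡0)

↑ˡ≢↑ʳ : ∀ {a b} (i : Fin a) (j : Fin b) → i ↑ˡ b ≢ a ↑ʳ j
↑ˡ≢↑ʳ {a} {b} i j eq with () ← trans (sym (Finₚ.splitAt-↑ˡ a i b)) (trans (cong (splitAt a) eq) (Finₚ.splitAt-↑ʳ a b j))

-- Pascal's rule splits the c-subsets of Fin (1 + r) by whether they contain 0.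
choose-index : ∀ r c (P : Subset r) → ∣ P ∣ ≡ c → Fin (r C c)
choose-index zero    zero    []           _     = zero
choose-index (suc r) zero    _            _     = zero
choose-index (suc r) (suc c) (inside ∷ P)  ∣P∣≡ =
  subst Fin (nCk+nC[k+1]≡[n+1]C[k+1] r c) (choose-index r c P (suc-injective ∣P∣≡) ↑ˡ (r C suc c))
choose-index (suc r) (suc c) (outside ∷ P) ∣P∣≡ =
  subst Fin (nCk+nC[k+1]≡[n+1]C[k+1] r c) ((r C c) ↑ʳ choose-index r (suc c) P ∣P∣≡)

choose-index-injective : ∀ r c (P Q : Subset r) (∣P∣≡ : ∣ P ∣ ≡ c) (∣Q∣≡ : ∣ Q ∣ ≡ c) →
                         choose-index r c P ∣P∣≡ ≡ choose-index r c Q ∣Q∣≡ → P ≡ Q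
choose-index-injective zero    zero    []            []            _    _    _  = refl
choose-index-injective (suc r) zero    P             Q             ∣P∣≡ ∣Q∣≡ _  =
  trans (∣p∣≡0⇒p≡⊥ ∣P∣≡) (sym (∣p∣≡0⇒p≡⊥ ∣Q∣≡))
choose-index-injective (suc r) (suc c) (inside ∷ P)  (inside ∷ Q)  ∣P∣≡ ∣Q∣≡ eq =
  cong (inside ∷_) (choose-index-injective r c P Q _ _
    (Finₚ.↑ˡ-injective _ _ _ (subst-injective (nCk+nC[k+1]≡[n+1]C[k+1] r c) eq)))
choose-index-injective (suc r) (suc c) (inside ∷ P)  (outside ∷ Q) ∣P∣≡ ∣Q∣≡ eq =
  ⊥-elim (↑ˡ≢↑ʳ _ _ (subst-injective (nCk+nC[k+1]≡[n+1]C[k+1] r c) eq))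
choose-index-injective (suc r) (suc c) (outside ∷ P) (inside ∷ Q)  ∣P∣≡ ∣Q∣≡ eq =
  ⊥-elim (↑ˡ≢↑ʳ _ _ (sym (subst-injective (nCk+nC[k+1]≡[n+1]C[k+1] r c) eq)))
choose-index-injective (suc r) (suc c) (outside ∷ P) (outside ∷ Q) ∣P∣≡ ∣Q∣≡ eq =
  cong (outside ∷_) (choose-index-injective r (suc c) P Q _ _
    (Finₚ.↑ʳ-injective _ _ _ (subst-injective (nCk+nC[k+1]≡[n+1]C[k+1] r c) eq)))

injective-subsets⇒≤C : ∀ {q c} {A : Subset N} {P : Fin q → Subset N} → Injective _≡_ _≡_ P →
                       (∀ j → P j ⊆ A) → (∀ j → ∣ P j ∣ ≡ c) → q ≤ ∣ A ∣ C c
injective-subsets⇒≤C {c = c} {A} {P} P-inj P⊆A ∣P∣≡c = Finₚ.injective⇒≤ index-injective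
  where
  index : _ → Fin (∣ A ∣ C c)
  index j = choose-index ∣ A ∣ c (restrict A (P j)) (trans (∣restrict∣ (P⊆A j)) (∣P∣≡c j))
  index-injective : Injective _≡_ _≡_ index
  index-injective eq = P-inj (restrict-injective (P⊆A _) (P⊆A _) (choose-index-injective _ _ _ _ _ _ eq))

-- Double counting

χ : Subset N → Fin N → ℕ
χ p x = if lookup p x then 1 else 0

∣p∣≡∑χ : (p : Subset N) → ∣ p ∣ ≡ ∑[ x < N ] χ p x
∣p∣≡∑χ []            = refl
∣p∣≡∑χ (inside ∷ p)  = cong suc (∣p∣≡∑χ p)
∣p∣≡∑χ (outside ∷ p) = ∣p∣≡∑χ p

χ-∈ : {p : Subset N} {x : Fin N} → x ∈ p → χ p x ≡ 1
χ-∈ {p = p} {x} x∈p rewrite []=⇒lookup x∈p = refl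

χ-∩ : (p q : Subset N) (x : Fin N) → χ (p ∩ q) x ≡ χ p x * χ q x
χ-∩ p q x rewrite lookup-zipWith _∧_ x p q with lookup p x | lookup q x
... | true  | true  = refl
... | true  | false = refl
... | false | _     = refl

transpose : (Fin k → Subset N) → Fin N → Subset k
transpose Γ a = tabulate (λ e → lookup (Γ e) a)

χ-transpose : (Γ : Fin k → Subset N) (a : Fin N) (e : Fin k) → χ (transpose Γ a) e ≡ χ (Γ e) a
χ-transpose Γ a e = cong (λ b → if b then 1 else 0) (lookup∘tabulate (λ e → lookup (Γ e) a) e)

∈-transpose⁻ : {Γ : Fin k → Subset N} {a : Fin N} {e : Fin k} → e ∈ transpose Γ a → a ∈ Γ e
∈-transpose⁻ {Γ = Γ} {a} {e} e∈ =
  lookup⇒[]= a (Γ e) (trans (sym (lookup∘tabulate (λ e → lookup (Γ e) a) e)) ([]=⇒lookup e∈))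

∑χ*∣Γ∣≡∑∣∩transpose∣ : (Γ : Fin k → Subset N) (K : Subset k) →
                        ∑[ e < k ] (χ K e * ∣ Γ e ∣) ≡ ∑[ a < N ] ∣ K ∩ transpose Γ a ∣
∑χ*∣Γ∣≡∑∣∩transpose∣ {k = k} {N} Γ K = begin
  ∑[ e < k ] (χ K e * ∣ Γ e ∣)                      ≡⟨ sum-cong-≗ (λ e → cong (χ K e *_) (∣p∣≡∑χ (Γ e))) ⟩
  ∑[ e < k ] (χ K e * ∑[ a < N ] χ (Γ e) a)         ≡⟨ sum-cong-≗ (λ e → *-distribˡ-sum (χ K e) (χ (Γ e))) ⟩
  ∑[ e < k ] ∑[ a < N ] (χ K e * χ (Γ e) a)         ≡⟨ ∑-comm (λ e a → χ K e * χ (Γ e) a) ⟩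
  ∑[ a < N ] ∑[ e < k ] (χ K e * χ (Γ e) a)         ≡⟨ sum-cong-≗ (λ a → sum-cong-≗ (λ e → χK∩ a e)) ⟨
  ∑[ a < N ] ∑[ e < k ] χ (K ∩ transpose Γ a) e     ≡⟨ sum-cong-≗ (λ a → ∣p∣≡∑χ (K ∩ transpose Γ a)) ⟨
  ∑[ a < N ] ∣ K ∩ transpose Γ a ∣                  ∎
  where
  open ≡-Reasoning
  χK∩ : ∀ a e → χ (K ∩ transpose Γ a) e ≡ χ K e * χ (Γ e) a
  χK∩ a e = trans (χ-∩ K (transpose Γ a) e) (cong (χ K e *_) (χ-transpose Γ a e))

double-counting : {Γ : Fin k → Subset N} {d m : ℕ} (K : Subset k) → (∀ e → d ≤ ∣ Γ e ∣) →
                  (∀ a → a ∈ neighbours Γ K → ∣ K ∩ transpose Γ a ∣ ≤ m) →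
                  d * ∣ K ∣ ≤ m * ∣ neighbours Γ K ∣
double-counting {k = k} {N} {Γ} {d} {m} K d≤∣Γ∣ ∣K∩Γᵀ∣≤m = begin
  d * ∣ K ∣                                  ≡⟨ cong (d *_) (∣p∣≡∑χ K) ⟩
  d * ∑[ e < k ] χ K e                       ≡⟨ *-distribˡ-sum d (χ K) ⟩
  ∑[ e < k ] (d * χ K e)                     ≤⟨ ∑-mono-≤ (λ e → ≤-trans (≤-reflexive (*-comm d (χ K e))) (*-monoʳ-≤ (χ K e) (d≤∣Γ∣ e))) ⟩
  ∑[ e < k ] (χ K e * ∣ Γ e ∣)               ≡⟨ ∑χ*∣Γ∣≡∑∣∩transpose∣ Γ K ⟩
  ∑[ a < N ] ∣ K ∩ transpose Γ a ∣           ≤⟨ ∑-mono-≤ ∣K∩Γᵀ∣≤mχ ⟩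
  ∑[ a < N ] (m * χ (neighbours Γ K) a)      ≡⟨ *-distribˡ-sum m (χ (neighbours Γ K)) ⟨
  m * ∑[ a < N ] χ (neighbours Γ K) a        ≡⟨ cong (m *_) (∣p∣≡∑χ (neighbours Γ K)) ⟨
  m * ∣ neighbours Γ K ∣                     ∎
  where
  open ≤-Reasoning
  ∣K∩Γᵀ∣≤mχ : ∀ a → ∣ K ∩ transpose Γ a ∣ ≤ m * χ (neighbours Γ K) a
  ∣K∩Γᵀ∣≤mχ a with a ∈? neighbours Γ K
  ... | yes a∈ = ≤-trans (∣K∩Γᵀ∣≤m a a∈) (≤-reflexive (trans (sym (*-identityʳ m)) (cong (m *_) (sym (χ-∈ a∈)))))
  ... | no  a∉ = ≤-trans (≤-reflexive (trans (cong ∣_∣ (Empty-unique none)) (∣⊥∣≡0 k))) z≤n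
    where
    none : Empty (K ∩ transpose Γ a)
    none (e , e∈) = a∉ (∈-neighbours⁺ (p∩q⊆p K _ e∈) (∈-transpose⁻ {Γ = Γ} (p∩q⊆q K _ e∈)))

-- Replacing each e by d copies turns a d-fold transversal of Γ into an ordinary one.
blowUp : (d : ℕ) → (Fin k → Subset N) → Fin (d * k) → Subset N
blowUp {k = k} d Γ c = Γ (proj₂ (remQuot {d} k c))

hallCondition-blowUp : {Γ : Fin k → Subset N} {d : ℕ} →
                       (∀ K → d * ∣ K ∣ ≤ ∣ neighbours Γ K ∣) → HallCondition (blowUp d Γ)
hallCondition-blowUp {k = k} {N} {Γ} {d} d-fold-hall S = begin
  ∣ S ∣                          ≤⟨ p⊆q⇒∣p∣≤∣q∣ S⊆copies ⟩
  ∣ neighbours copies K ∣        ≤⟨ ∣neighbours∣≤b*∣S∣ (λ e → ≤-reflexive (∣copies∣≡d e)) K ⟩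
  d * ∣ K ∣                      ≤⟨ d-fold-hall K ⟩
  ∣ neighbours Γ K ∣             ≤⟨ p⊆q⇒∣p∣≤∣q∣ (neighbours-least K Γ⊆) ⟩
  ∣ neighbours (blowUp d Γ) S ∣  ∎
  where
  open ≤-Reasoning
  original : Fin (d * k) → Fin k
  original c = proj₂ (remQuot {d} k c)
  K = image original S
  copy : Fin k → Fin d → Fin (d * k)
  copy e s = combine s e
  copies : Fin k → Subset (d * k)
  copies e = image (copy e) ⊤
  ∣copies∣≡d : ∀ e → ∣ copies e ∣ ≡ d
  ∣copies∣≡d e = trans (∣image∣≡∣p∣ {f = copy e} (λ {s} {s′} eq → proj₁ (Finₚ.combine-injective s e s′ e eq)) ⊤) (∣⊤∣≡n d)
  S⊆copies : S ⊆ neighbours copies K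
  S⊆copies {c} c∈S = subst (_∈ neighbours copies K) (Finₚ.combine-remQuot {d} k c)
    (∈-neighbours⁺ {Γ = copies} (∈-image⁺ {f = original} c∈S) (∈-image⁺ {f = copy (original c)} ∈⊤))
  Γ⊆ : ∀ {e} → e ∈ K → Γ e ⊆ neighbours (blowUp d Γ) S
  Γ⊆ e∈K with c , c∈S , refl ← ∈-image⁻ original e∈K = ∈-neighbours⁺ c∈S

[,]′-injective : ∀ {a b c} {A : Set a} {B : Set b} {C : Set c} {f : A → C} {g : B → C} →
                 Injective _≡_ _≡_ f → Injective _≡_ _≡_ g → (∀ x y → f x ≢ g y) →
                 Injective _≡_ _≡_ [ f , g ]′
[,]′-injective f-inj g-inj f≢g {inj₁ x} {inj₁ x′} eq = cong inj₁ (f-inj eq)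
[,]′-injective f-inj g-inj f≢g {inj₁ x} {inj₂ y′} eq = ⊥-elim (f≢g x y′ eq)
[,]′-injective f-inj g-inj f≢g {inj₂ y} {inj₁ x′} eq = ⊥-elim (f≢g x′ y (sym eq))
[,]′-injective f-inj g-inj f≢g {inj₂ y} {inj₂ y′} eq = cong inj₂ (g-inj eq)

splitAt-injective : ∀ a {b} → Injective _≡_ _≡_ (splitAt a {b})
splitAt-injective a {b} {x} {y} eq =
  trans (sym (Finₚ.join-splitAt a b x)) (trans (cong (join a b) eq) (Finₚ.join-splitAt a b y))

∈-++⁺ˡ : ∀ {a b} {P : Subset a} {Q : Subset b} {u} → u ∈ P → (u ↑ˡ b) ∈ P ++ Q
∈-++⁺ˡ here       = here
∈-++⁺ˡ (there u∈) = there (∈-++⁺ˡ u∈)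

∈-++⁺ʳ : ∀ {a b} (P : Subset a) {Q : Subset b} {w} → w ∈ Q → (a ↑ʳ w) ∈ P ++ Q
∈-++⁺ʳ []      w∈ = w∈
∈-++⁺ʳ (_ ∷ P) w∈ = there (∈-++⁺ʳ P w∈)

∈-++⁻ : ∀ {a b} (P : Subset a) {Q : Subset b} {x} → x ∈ P ++ Q →
        (∃ λ u → u ∈ P × u ↑ˡ b ≡ x) ⊎ (∃ λ w → w ∈ Q × a ↑ʳ w ≡ x)
∈-++⁻ []      x∈         = inj₂ (_ , x∈ , refl)
∈-++⁻ (_ ∷ P) here       = inj₁ (zero , here , refl)
∈-++⁻ (_ ∷ P) (there x∈) with ∈-++⁻ P x∈
... | inj₁ (u , u∈ , refl) = inj₁ (suc u , there u∈ , refl)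
... | inj₂ (w , w∈ , refl) = inj₂ (w , w∈ , refl)

linear-contained : {H G : Hypergraph} → Contains H G → Linear H → Linear G
linear-contained {H} {G} (φ , φ-inj , ψ , ψ-inj , ψ-edge) H-linear j j′ j≢j′ = begin
  ∣ edge G j ∩ edge G j′ ∣               ≡⟨ ∣image∣≡∣p∣ φ-inj _ ⟨
  ∣ image φ (edge G j ∩ edge G j′) ∣     ≤⟨ p⊆q⇒∣p∣≤∣q∣ image⊆ ⟩
  ∣ edge H (ψ j) ∩ edge H (ψ j′) ∣       ≤⟨ H-linear (ψ j) (ψ j′) (j≢j′ ∘ ψ-inj) ⟩
  1                                      ∎
  where
  open ≤-Reasoning
  image⊆ : image φ (edge G j ∩ edge G j′) ⊆ edge H (ψ j) ∩ edge H (ψ j′)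
  image⊆ y∈ with x , x∈ , refl ← ∈-image⁻ φ y∈ = x∈p∩q⁺
    ( Equivalence.from (ψ-edge j  (φ x)) (x , p∩q⊆p _ _ x∈ , refl)
    , Equivalence.from (ψ-edge j′ (φ x)) (x , p∩q⊆q _ _ x∈ , refl))

subhypergraph : (H : Hypergraph) {k : ℕ} (g : Fin k → Fin (m H)) → Injective _≡_ _≡_ g → Hypergraph
subhypergraph H g g-inj = record { n = n H ; m = _ ; edge = edge H ∘ g ; distinct = g-inj ∘ distinct H }

contains-subhypergraph : {H : Hypergraph} {k : ℕ} {g : Fin k → Fin (m H)} (g-inj : Injective _≡_ _≡_ g) →
                         Contains H (subhypergraph H g g-inj)
contains-subhypergraph {g = g} g-inj =
  (λ x → x) , (λ eq → eq) , g , g-inj , λ j y → mk⇔ (λ y∈ → y , y∈ , refl) (λ (x , x∈ , x≡y) → subst (_∈ _) x≡y x∈)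

module HeavyCopy {t : ℕ} {F : Graph} {H : Hypergraph}
                 {i : Fin (|V| F) → Fin (n H)} {h : Fin (|E| F) → Fin t → Fin (m H)}
                 (copy : HeavyData t F H i h) where

  i-injective : Injective _≡_ _≡_ i
  i-injective = proj₁ copy

  h-injective : ∀ e → Injective _≡_ _≡_ (h e)
  h-injective = proj₁ (proj₂ copy)

  h-∋ : ∀ e s x → x ∈ edge (hg F) e → i x ∈ edge H (h e s)
  h-∋ = proj₂ (proj₂ copy)

  endpoints : Fin (|E| F) → Subset (n H)
  endpoints e = image i (edge (hg F) e)

  ∣endpoints∣≡2 : ∀ e → ∣ endpoints e ∣ ≡ 2
  ∣endpoints∣≡2 e = trans (∣image∣≡∣p∣ i-injective _) (uniform F e)

  endpoints⊆ : ∀ e s → endpoints e ⊆ edge H (h e s)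
  endpoints⊆ e s y∈ with x , x∈ , refl ← ∈-image⁻ i y∈ = h-∋ e s x x∈

  endpoints-injective : Injective _≡_ _≡_ endpoints
  endpoints-injective eq = distinct (hg F)
    (⊆-antisym (image-⊆⁻ i-injective (⊆-reflexive eq)) (image-⊆⁻ i-injective (⊆-reflexive (sym eq))))

  hyperedges : Fin (|E| F) → Subset (m H)
  hyperedges e = image (h e) ⊤

  ∣hyperedges∣≡t : ∀ e → ∣ hyperedges e ∣ ≡ t
  ∣hyperedges∣≡t e = trans (∣image∣≡∣p∣ (h-injective e) ⊤) (∣⊤∣≡n t)

¬linear-heavyCopy : ∀ {t F G} → 2 ≤ t → Fin (|E| F) → IsHeavyCopy t F G → ¬ Linear G
¬linear-heavyCopy {F = F} {G} (s≤s (s≤s _)) e (i , h , copy) G-linear = 1+n≰n (begin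
  2                                               ≡⟨ ∣endpoints∣≡2 e ⟨
  ∣ endpoints e ∣                                 ≤⟨ p⊆q⇒∣p∣≤∣q∣ (λ y∈ → x∈p∩q⁺ (endpoints⊆ e zero y∈ , endpoints⊆ e (suc zero) y∈)) ⟩
  ∣ edge G (h e zero) ∩ edge G (h e (suc zero)) ∣ ≤⟨ G-linear _ _ (Finₚ.0≢1+n ∘ h-injective e) ⟩
  1                                               ∎)
  where
  open ≤-Reasoning
  open HeavyCopy {F = F} {G} copy

module _ {t r : ℕ} {F : Graph} {H : Hypergraph}
         {i : Fin (|V| F) → Fin (n H)} {h : Fin (|E| F) → Fin t → Fin (m H)}
         (copy : HeavyData t F H i h) (H-uniform : Uniform r H) where

  open HeavyCopy {F = F} {H} copy

  -- The edges e ∈ K whose heavy hyperedges include a have distinct endpoint pairs inside a.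
  ∣K∩transpose∣≤rC2 : ∀ K a → ∣ K ∩ transpose hyperedges a ∣ ≤ r C 2
  ∣K∩transpose∣≤rC2 K a = subst (λ w → ∣ S ∣ ≤ w C 2) (H-uniform a)
    (injective-subsets⇒≤C (enum-injective S ∘ endpoints-injective)
                          (λ j → endpoints⊆a (enum-∈ S j)) (λ j → ∣endpoints∣≡2 (enum S j)))
    where
    S = K ∩ transpose hyperedges a
    endpoints⊆a : ∀ {e} → e ∈ S → endpoints e ⊆ edge H a
    endpoints⊆a {e} e∈S with s , _ , refl ← ∈-image⁻ (h e) (∈-transpose⁻ {Γ = hyperedges} (p∩q⊆q K _ e∈S)) =
      endpoints⊆ e s

  multiple-hallCondition : ∀ {t′} .{{_ : NonZero ((r C 2) ⊓ |E| F)}} → t′ * ((r C 2) ⊓ |E| F) ≤ t →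
                           ∀ K → t′ * ∣ K ∣ ≤ ∣ neighbours hyperedges K ∣
  multiple-hallCondition {t′} t′μ≤t K = *-cancelˡ-≤ μ (begin
    μ * (t′ * ∣ K ∣)                 ≡⟨ *-assoc μ t′ ∣ K ∣ ⟨
    μ * t′ * ∣ K ∣                   ≡⟨ cong (_* ∣ K ∣) (*-comm μ t′) ⟩
    t′ * μ * ∣ K ∣                   ≤⟨ *-monoˡ-≤ ∣ K ∣ t′μ≤t ⟩
    t * ∣ K ∣                        ≤⟨ double-counting K (≤-reflexive ∘ sym ∘ ∣hyperedges∣≡t) μ-bound ⟩
    μ * ∣ neighbours hyperedges K ∣  ∎)
    where
    open ≤-Reasoning
    μ = (r C 2) ⊓ |E| F
    μ-bound : ∀ a → a ∈ neighbours hyperedges K → ∣ K ∩ transpose hyperedges a ∣ ≤ μ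
    μ-bound a _ = ⊓-glb (∣K∩transpose∣≤rC2 K a) (∣p∣≤n (K ∩ transpose hyperedges a))

  transversal⇒bergeCopy : ∀ {t′} → Transversal (blowUp t′ hyperedges) →
                          Σ Hypergraph λ B → Contains H B × InBerge r t′ F B
  transversal⇒bergeCopy {t′} (g , g-inj , g∈) =
      subhypergraph H g g-inj , contains-subhypergraph {H = H} g-inj
    , H-uniform ∘ g , refl , i , h′ , (i-injective , h′-injective , h′-∋) , h′-disjoint
    where
    h′ : Fin (|E| F) → Fin t′ → Fin (t′ * |E| F)
    h′ e s = combine s e
    h′-injective : ∀ e → Injective _≡_ _≡_ (h′ e)
    h′-injective e {s} {s′} eq = proj₁ (Finₚ.combine-injective s e s′ e eq)
    h′-disjoint : ∀ e e′ → e ≢ e′ → ∀ s s′ → h′ e s ≢ h′ e′ s′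
    h′-disjoint e e′ e≢e′ s s′ eq = e≢e′ (proj₂ (Finₚ.combine-injective s e s′ e′ eq))
    g∈hyperedges : ∀ e s → g (h′ e s) ∈ hyperedges e
    g∈hyperedges e s = subst (λ e′ → g (h′ e s) ∈ hyperedges e′) (cong proj₂ (Finₚ.remQuot-combine s e)) (g∈ (h′ e s))
    h′-∋ : ∀ e s x → x ∈ edge (hg F) e → i x ∈ edge H (g (h′ e s))
    h′-∋ e s x x∈ with s₀ , _ , eq ← ∈-image⁻ (h e) (g∈hyperedges e s) =
      subst (λ a → i x ∈ edge H a) eq (h-∋ e s₀ x x∈)

  heavyCopy⇒bergeCopy : ∀ {t′} .{{_ : NonZero ((r C 2) ⊓ |E| F)}} → t′ * ((r C 2) ⊓ |E| F) ≤ t →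
                        Σ Hypergraph λ B → Contains H B × InBerge r t′ F B
  heavyCopy⇒bergeCopy {t′} t′μ≤t =
    transversal⇒bergeCopy (hall-theorem (hallCondition-blowUp {d = t′} (multiple-hallCondition {t′} t′μ≤t)))

module _ {t : ℕ} {F : Graph} {H : Hypergraph}
         {i : Fin (|V| F) → Fin (n H)} {h : Fin (|E| F) → Fin t → Fin (m H)}
         (copy : HeavyData t F H i h) (H-uniform : Uniform 3 H) where

  open HeavyCopy {F = F} {H} copy

  private
    third-vertex : ∀ e s → ∃ λ z → z ∈ edge H (h e s) × z ∉ endpoints e ×
                                   (∀ {y} → y ∈ edge H (h e s) → y ∈ endpoints e ⊎ y ≡ z)
    third-vertex e s = ∣p∣≡1+∣q∣⇒∃!∉ (endpoints⊆ e s) (trans (H-uniform (h e s)) (cong suc (sym (∣endpoints∣≡2 e))))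

  third : Fin (|E| F) → Fin t → Fin (n H)
  third e s = proj₁ (third-vertex e s)

  third-∈ : ∀ e s → third e s ∈ edge H (h e s)
  third-∈ e s = proj₁ (proj₂ (third-vertex e s))

  third-∉ : ∀ e s → third e s ∉ endpoints e
  third-∉ e s = proj₁ (proj₂ (proj₂ (third-vertex e s)))

  endpoints⊎third : ∀ e s {y} → y ∈ edge H (h e s) → y ∈ endpoints e ⊎ y ≡ third e s
  endpoints⊎third e s = proj₂ (proj₂ (proj₂ (third-vertex e s)))

  third-injective : ∀ e → Injective _≡_ _≡_ (third e)
  third-injective e eq = h-injective e (distinct H (⊆-antisym (edge⊆ eq) (edge⊆ (sym eq))))
    where
    edge⊆ : ∀ {s s′} → third e s ≡ third e s′ → edge H (h e s) ⊆ edge H (h e s′)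
    edge⊆ {s} {s′} eq y∈ with endpoints⊎third e s y∈
    ... | inj₁ y∈ends = endpoints⊆ e s′ y∈ends
    ... | inj₂ refl   = subst (_∈ edge H (h e s′)) (sym eq) (third-∈ e s′)

  copyVertices : Subset (n H)
  copyVertices = image i ⊤

  endpoints⊆copyVertices : ∀ e → endpoints e ⊆ copyVertices
  endpoints⊆copyVertices e y∈ with x , _ , refl ← ∈-image⁻ i y∈ = ∈-image⁺ {f = i} ∈⊤

  freshThirds : Fin (|E| F) → Subset (n H)
  freshThirds e = image (third e) ⊤ ─ copyVertices

  -- At most |V| - 2 of the t distinct third vertices of e lie in the copy of F.
  |E|≤∣freshThirds∣ : |V| F + |E| F ∸ 2 ≤ t → ∀ e → |E| F ≤ ∣ freshThirds e ∣
  |E|≤∣freshThirds∣ t-large e = +-cancelʳ-≤ (∣ X ∣) (|E| F) (∣ freshThirds e ∣) (begin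
    |E| F + ∣ X ∣                      ≡⟨ m+n∸n≡m (|E| F + ∣ X ∣) 2 ⟨
    |E| F + ∣ X ∣ + 2 ∸ 2              ≡⟨ cong (_∸ 2) (trans (+-assoc (|E| F) ∣ X ∣ 2) (+-comm (|E| F) _)) ⟩
    ∣ X ∣ + 2 + |E| F ∸ 2              ≡⟨ cong (λ v → v + |E| F ∸ 2) ∣X∣+2≡|V| ⟩
    |V| F + |E| F ∸ 2                  ≤⟨ t-large ⟩
    t                                  ≡⟨ trans (∣image∣≡∣p∣ (third-injective e) ⊤) (∣⊤∣≡n t) ⟨
    ∣ image (third e) ⊤ ∣              ≤⟨ p⊆q⇒∣p∣≤∣q∣ thirds⊆ ⟩
    ∣ freshThirds e ∪ X ∣              ≤⟨ ∣p∪q∣≤∣p∣+∣q∣ (freshThirds e) X ⟩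
    ∣ freshThirds e ∣ + ∣ X ∣          ∎)
    where
    open ≤-Reasoning
    X = copyVertices ─ endpoints e
    ∣X∣+2≡|V| : ∣ X ∣ + 2 ≡ |V| F
    ∣X∣+2≡|V| = begin-equality
      ∣ X ∣ + 2                 ≡⟨ cong (∣ X ∣ +_) (∣endpoints∣≡2 e) ⟨
      ∣ X ∣ + ∣ endpoints e ∣   ≡⟨ ∣p─q∣+∣q∣≡∣p∣ (endpoints⊆copyVertices e) ⟩
      ∣ copyVertices ∣          ≡⟨ ∣image∣≡∣p∣ i-injective ⊤ ⟩
      ∣ ⊤ {n = |V| F} ∣         ≡⟨ ∣⊤∣≡n (|V| F) ⟩
      |V| F                     ∎
    thirds⊆ : image (third e) ⊤ ⊆ freshThirds e ∪ X
    thirds⊆ {y} y∈ with s , _ , refl ← ∈-image⁻ (third e) y∈ with third e s ∈? copyVertices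
    ... | yes ∈copy = x∈p∪q⁺ (inj₂ (x∈p∧x∉q⇒x∈p─q ∈copy (third-∉ e s)))
    ... | no  ∉copy = x∈p∪q⁺ (inj₁ (x∈p∧x∉q⇒x∈p─q y∈ ∉copy))

  module FreshEmbedding (freshTransversal : Transversal freshThirds) where

    fresh : Fin (|E| F) → Fin (n H)
    fresh = proj₁ freshTransversal

    fresh-injective : Injective _≡_ _≡_ fresh
    fresh-injective = proj₁ (proj₂ freshTransversal)

    fresh-∈ : ∀ e → fresh e ∈ freshThirds e
    fresh-∈ = proj₂ (proj₂ freshTransversal)

    fresh-∉ : ∀ e → fresh e ∉ copyVertices
    fresh-∉ e = x∈p─q⇒x∉q (fresh-∈ e)

    σ : Fin (|E| F) → Fin t
    σ e = proj₁ (∈-image⁻ (third e) (p─q⊆p _ _ (fresh-∈ e)))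

    third-σ : ∀ e → third e (σ e) ≡ fresh e
    third-σ e = proj₂ (proj₂ (∈-image⁻ (third e) (p─q⊆p _ _ (fresh-∈ e))))

    φ : Fin (|V| F + |E| F) → Fin (n H)
    φ = [ i , fresh ]′ ∘ splitAt (|V| F)

    φ-injective : Injective _≡_ _≡_ φ
    φ-injective = splitAt-injective (|V| F) ∘ [,]′-injective i-injective fresh-injective i≢fresh
      where
      i≢fresh : ∀ u e → i u ≢ fresh e
      i≢fresh u e eq = fresh-∉ e (subst (_∈ copyVertices) eq (∈-image⁺ {f = i} ∈⊤))

    φ-↑ˡ : ∀ u → φ (u ↑ˡ |E| F) ≡ i u
    φ-↑ˡ u = cong [ i , fresh ]′ (Finₚ.splitAt-↑ˡ (|V| F) u (|E| F))

    φ-↑ʳ : ∀ e → φ (|V| F ↑ʳ e) ≡ fresh e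
    φ-↑ʳ e = cong [ i , fresh ]′ (Finₚ.splitAt-↑ʳ (|V| F) (|E| F) e)

    ψ : Fin (|E| F) → Fin (m H)
    ψ e = h e (σ e)

    fresh∈ψ : ∀ e → fresh e ∈ edge H (ψ e)
    fresh∈ψ e = subst (_∈ edge H (ψ e)) (third-σ e) (third-∈ e (σ e))

    ψ-injective : Injective _≡_ _≡_ ψ
    ψ-injective {e} {e′} eq with endpoints⊎third e′ (σ e′) (subst (λ a → fresh e ∈ edge H a) eq (fresh∈ψ e))
    ... | inj₁ ∈ends = ⊥-elim (fresh-∉ e (endpoints⊆copyVertices e′ ∈ends))
    ... | inj₂ ≡third = fresh-injective (trans ≡third (third-σ e′))

    ψ-edge : ∀ e y → (y ∈ edge H (ψ e)) ⇔ (∃ λ x → x ∈ edge (expansion F) e × φ x ≡ y)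
    ψ-edge e y = mk⇔ to from
      where
      to : y ∈ edge H (ψ e) → ∃ λ x → x ∈ edge (expansion F) e × φ x ≡ y
      to y∈ with endpoints⊎third e (σ e) y∈
      ... | inj₁ y∈ends with u , u∈ , refl ← ∈-image⁻ i y∈ends = u ↑ˡ |E| F , ∈-++⁺ˡ u∈ , φ-↑ˡ u
      ... | inj₂ refl = |V| F ↑ʳ e , ∈-++⁺ʳ (edge (hg F) e) (x∈⁅x⁆ e) , trans (φ-↑ʳ e) (sym (third-σ e))
      from : (∃ λ x → x ∈ edge (expansion F) e × φ x ≡ y) → y ∈ edge H (ψ e)
      from (x , x∈ , refl) with ∈-++⁻ (edge (hg F) e) x∈
      ... | inj₁ (u , u∈ , refl) = subst (_∈ edge H (ψ e)) (sym (φ-↑ˡ u)) (h-∋ e (σ e) u u∈)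
      ... | inj₂ (w , w∈ , refl) with refl ← x∈⁅y⁆⇒x≡y e w∈ = subst (_∈ edge H (ψ e)) (sym (φ-↑ʳ e)) (fresh∈ψ e)

    contains-expansion : Contains H (expansion F)
    contains-expansion = φ , φ-injective , ψ , ψ-injective , ψ-edge

  heavyCopy⇒expansion : |V| F + |E| F ∸ 2 ≤ t → Contains H (expansion F)
  heavyCopy⇒expansion t-large =
    FreshEmbedding.contains-expansion (hall-theorem (k≤∣Γ∣⇒hallCondition (|E|≤∣freshThirds∣ t-large)))

proposition2 :
  ((F : Graph) (t : ℕ) → 2 ≤ t → 1 ≤ |E| F →
    (H : Hypergraph) → Linear H →
    ¬ (Σ Hypergraph λ G → Contains H G × IsHeavyCopy t F G))
  ×
  ((F : Graph) (r t : ℕ) → 2 ≤ r → 1 ≤ t →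
    .{{_ : NonZero ((r C 2) ⊓ |E| F)}} →
    (H : Hypergraph) → Uniform r H → IsHeavyCopy t F H →
    Σ Hypergraph λ B → Contains H B × InBerge r (t / ((r C 2) ⊓ |E| F)) F B)
  ×
  ((F : Graph) (t : ℕ) → 1 ≤ t → |V| F + |E| F ∸ 2 ≤ t →
    (H : Hypergraph) → Uniform 3 H → IsHeavyCopy t F H →
    Contains H (expansion F))
proposition2 =
    (λ F t 2≤t 1≤|E| H H-linear (G , H⊇G , heavy) →
       ¬linear-heavyCopy {F = F} {G} 2≤t (Fin.fromℕ< 1≤|E|) heavy (linear-contained {H} {G} H⊇G H-linear))
  , (λ F r t _ _ H H-uniform (_ , _ , copy) →
       heavyCopy⇒bergeCopy {F = F} {H} copy H-uniform (m/n*n≤m t ((r C 2) ⊓ |E| F)))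
  , (λ F t _ t-large H H-uniform (_ , _ , copy) → heavyCopy⇒expansion {F = F} {H} copy H-uniform t-large)
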